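{- Let $w$ be a permutation of $\mathbb Z_{>0}$ fixing all but finitely many integers, and let $n$ be such that $w$ fixes all integers $>n$. Then: (1) if $(i,j)$ is an addable cell of $\mathrm{dom}(w)$, then $j=w(i)$; (2) $\mathrm{dom}(w)=\mathrm{dom}(\mathcal P)$ for all $\mathcal P\in\overline{\mathsf{Pipes}}(w)$; (3) if $(i,j)$ is an addable cell of $\mathrm{dom}(w)$, then $(i,j)\notin\mathcal P$ for all $\mathcal P\in\overline{\mathsf{Pipes}}(w)$.
   Context: Rothe diagram $D(w)=\{(i,j):j<w(i),\ i<w^{ -1}(j)\}$. For a partition $\lambda$ (possibly empty), the Young diagram is $\mathbb Y_\lambda=\{(i,j):1\le j\le\lambda_i\}$. For a finite set $U$ of cells, $\mathrm{dom}(U)$ is the largest Young diagram contained in $U$; $\mathrm{dom}(w)=\mathrm{dom}(D(w))$. An addable cell of $\mathbb Y_\lambda$ is $(i,j)\notin\mathbb Y_\lambda$ with $(i-1,j)\in\mathbb Y_\lambda$ if $i>1$ and $(i,j-1)\in\mathbb Y_\lambda$ if $j>1$. Demazure product: $\delta(\emptyset)=\mathrm{id}$, $\delta(a_1,\dots,a_k)=\delta(a_1,\dots,a_{k-1})*\tau_{a_k}$, $v*\tau_m=vs_m$ if $\ell(vs_m)>\ell(v)$, else $v$ ($s_m=(m\ m+1)$). $\mathbb T_n=\{(i,j)\in[n]^2:i+j\le n\}$; a pipe dream of size $n$ is $\mathcal P\subseteq\mathbb T_n$, with word $\mathbf a_{\mathcal P}$ listing its cells column by column from right to left, top to bottom within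 columns, recording $i+j-1$ for $(i,j)$; $\delta(\mathcal P)=\delta(\mathbf a_{\mathcal P})$; $\overline{\mathsf{Pipes}}(w)=\{\mathcal P\subseteq\mathbb T_n:\delta(\mathcal P)=w\}$. -}

module Defs where

open import Data.Nat using (ℕ; zero; suc; _+_; _∸_; _≤_; _<_; _<ᵇ_; _≡ᵇ_)
open import Data.Bool using (Bool; true; false; if_then_else_; _∧_)
open import Data.List using (List; []; _∷_; map; reverse; upTo; concatMap; foldl)
open import Data.Nat.ListAction using (sum)
open import Data.List.Relation.Unary.All using (All)
open import Data.List.Relation.Unary.Linked using (Linked)
open import Data.Product using (_×_)
open import Relation.Binary.PropositionalEquality using (_≡_)
open import Relation.Nullary using (¬_)

-- Positive integers are modelled by ℕ; the value 0 is a dummy point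
-- that every permutation fixes.

record Perm : Set where
  field
    fun     : ℕ → ℕ
    inv     : ℕ → ℕ
    inv-fun : ∀ k → inv (fun k) ≡ k
    fun-inv : ∀ k → fun (inv k) ≡ k
    fun-0   : fun 0 ≡ 0
open Perm public

Cells : Set₁
Cells = ℕ → ℕ → Set

_⊆_ : Cells → Cells → Set
U ⊆ V = ∀ i j → U i j → V i j

Rothe : Perm → Cells
Rothe w i j = (1 ≤ i) × (1 ≤ j) × (j < fun w i) × (i < inv w j)

IsPartition : List ℕ → Set
IsPartition λ′ = All (1 ≤_) λ′ × Linked (λ a b → b ≤ a) λ′

-- λ_i for i ≥ 1 (0 beyond the length): part λ (i-1)
part : List ℕ → ℕ → ℕ
part []       _       = 0
part (x ∷ xs) zero    = x
part (x ∷ xs) (suc k) = part xs k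

Young : List ℕ → Cells
Young λ′ i j = (1 ≤ i) × (1 ≤ j) × (j ≤ part λ′ (i ∸ 1))

IsDom : Cells → List ℕ → Set
IsDom U λ′ = IsPartition λ′ × (Young λ′ ⊆ U)
           × (∀ μ → IsPartition μ → Young μ ⊆ U → Young μ ⊆ Young λ′)

Addable : List ℕ → ℕ → ℕ → Set
Addable λ′ i j = (1 ≤ i) × (1 ≤ j) × ¬ Young λ′ i j
               × (1 < i → Young λ′ (i ∸ 1) j)
               × (1 < j → Young λ′ i (j ∸ 1))

-- Demazure product on S_n (all letters lie in [1, n-1]).

range1 : ℕ → List ℕ
range1 k = map suc (upTo k)

swap : ℕ → ℕ → ℕ
swap m k = if k ≡ᵇ m then suc m else (if k ≡ᵇ suc m then m else k)

len : ℕ → (ℕ → ℕ) → ℕ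
len n v = sum (concatMap (λ i → map (λ j → if (i <ᵇ j) ∧ (v j <ᵇ v i) then 1 else 0)
                                    (range1 n)) (range1 n))

demStep : ℕ → (ℕ → ℕ) → ℕ → (ℕ → ℕ)
demStep n v m = if len n v <ᵇ len n (λ k → v (swap m k)) then (λ k → v (swap m k)) else v

demazure : ℕ → List ℕ → (ℕ → ℕ)
demazure n = foldl (demStep n) (λ k → k)

IsPipeDream : ℕ → (ℕ → ℕ → Bool) → Set
IsPipeDream n P = ∀ i j → P i j ≡ true → (1 ≤ i) × (1 ≤ j) × (i + j ≤ n)

cellsOf : (ℕ → ℕ → Bool) → Cells
cellsOf P i j = P i j ≡ true

pipeWord : ℕ → (ℕ → ℕ → Bool) → List ℕ
pipeWord n P = concatMap (λ j → concatMap (λ i → if P i j then (i + j ∸ 1) ∷ [] else [])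
                                          (range1 (n ∸ j)))
                         (reverse (range1 (n ∸ 1)))

InPipesBar : ℕ → Perm → (ℕ → ℕ → Bool) → Set
InPipesBar n w P = IsPipeDream n P × (∀ k → demazure n (pipeWord n P) k ≡ fun w k)

{-# OPTIONS --safe #-}
-- On injective functions, right multiplication by s_m changes the number of inversions by
-- exactly one, so the length test in the Demazure product v * τ_m is the ascent test
-- v(m) < v(m+1).  Read column by column, the word of a pipe dream P of size n+1 first builds
-- the shift 1 × δ(P′) of the product for P′ = P without its first column; the crosses of
-- column 1, read top to bottom, then carry the value 1 down from row 1 to the first row k
-- without a cross.  Hence δ(P)(a) = δ(P′)(a) + 1 for a < k and δ(P)(k) = 1, and induction on n
-- shows that every cell (i, j) with j < δ(P)(a) for all a ≤ i lies in P, while no addable cell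
-- of this set does.  For a permutation w this set is dom(w), since the rectangle spanned by
-- such a cell lies in D(w); its addable cells (i, j) satisfy j = w(i).  Finally a Young diagram
-- inside P that avoids the addable cells of dom(w) lies inside dom(w).
module Submission where

open import Defs
open import Data.Nat using (ℕ; zero; suc; _+_; _∸_; _≤_; _<_; _<ᵇ_; _≡ᵇ_; z≤n; s≤s; z<s)
open import Data.Nat.Properties
open import Data.Bool using (Bool; true; false; if_then_else_; _∧_)
open import Data.List
  using (List; []; _∷_; replicate; _++_; map; upTo; applyUpTo; reverse; concatMap; foldl; filterᵇ)
open import Data.Nat.ListAction using (sum)
open import Data.Nat.ListAction.Properties using (sum-++)
open import Data.List.Properties
  using ( foldl-++; map-cong; map-++; map-∘; upTo-∷ʳ; map-applyUpTo; ++-identityʳ; unfold-reverse; reverse-map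
        ; concatMap-cong; concatMap-map; concatMap-++; map-concatMap )
open import Data.List.Relation.Unary.All as All using (All; []; _∷_)
open import Data.List.Relation.Unary.All.Properties using (++⁺; filter⁺; replicate⁺)
open import Data.List.Relation.Unary.Linked using (Linked; []; [-]; _∷_)
open import Data.Product using (_×_; _,_; proj₁; proj₂)
open import Data.Sum using (inj₁; inj₂)
open import Data.Empty using (⊥-elim)
open import Relation.Binary.Definitions using (tri<; tri≈; tri>)
open import Function using (id; _∘_; _⇔_; mk⇔; Equivalence)
open import Function.Definitions using (Injective)
open import Relation.Binary.PropositionalEquality
open import Relation.Nullary using (¬_; yes; no)
open import Relation.Nullary.Decidable using (dec-true; dec-false; T?)
open import Algebra.Properties.CommutativeSemigroup +-commutativeSemigroup using (xy∙z≈xz∙y)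

≡ᵇ-refl : ∀ m → (m ≡ᵇ m) ≡ true
≡ᵇ-refl m = dec-true (m ≟ m) refl

<ᵇ-cong-⇔ : ∀ {a b c d} → a < b ⇔ c < d → (a <ᵇ b) ≡ (c <ᵇ d)
<ᵇ-cong-⇔ {a} {b} {c} {d} a<b⇔c<d with a <? b
... | yes a<b = trans (dec-true (a <? b) a<b) (sym (dec-true (c <? d) (Equivalence.to a<b⇔c<d a<b)))
... | no a≮b  = trans (dec-false (a <? b) a≮b) (sym (dec-false (c <? d) (a≮b ∘ Equivalence.from a<b⇔c<d)))

<ᵇ-suc-right : ∀ {a m} → a ≢ m → (a <ᵇ suc m) ≡ (a <ᵇ m)
<ᵇ-suc-right a≢m = <ᵇ-cong-⇔ (mk⇔ (λ a<1+m → ≤∧≢⇒< (≤-pred a<1+m) a≢m) m<n⇒m<1+n)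

<ᵇ-suc-left : ∀ {m a} → a ≢ suc m → (suc m <ᵇ a) ≡ (m <ᵇ a)
<ᵇ-suc-left a≢1+m = <ᵇ-cong-⇔ (mk⇔ (<-trans (n<1+n _)) (λ m<a → ≤∧≢⇒< m<a (a≢1+m ∘ sym)))

swap-same : ∀ m → swap m m ≡ suc m
swap-same m rewrite ≡ᵇ-refl m = refl

swap-suc-same : ∀ m → swap m (suc m) ≡ m
swap-suc-same m rewrite dec-false (suc m ≟ m) (1+n≢n) | ≡ᵇ-refl (suc m) = refl

swap-other : ∀ {m a} → a ≢ m → a ≢ suc m → swap m a ≡ a
swap-other {m} {a} a≢m a≢1+m rewrite dec-false (a ≟ m) a≢m | dec-false (a ≟ suc m) a≢1+m = refl

data SwapView (m : ℕ) : ℕ → ℕ → Set where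
  at-m   : SwapView m m (suc m)
  at-1+m : SwapView m (suc m) m
  away   : ∀ {a} → a ≢ m → a ≢ suc m → SwapView m a a

swap-view : ∀ m a → SwapView m a (swap m a)
swap-view m a with a ≟ m | a ≟ suc m
... | yes refl | _        rewrite swap-same a = at-m
... | no _     | yes refl rewrite swap-suc-same m = at-1+m
... | no a≢m   | no a≢1+m rewrite swap-other a≢m a≢1+m = away a≢m a≢1+m

swap-involutive : ∀ m a → swap m (swap m a) ≡ a
swap-involutive m a with swap m a | swap-view m a
... | _ | at-m              = swap-suc-same m
... | _ | at-1+m            = swap-same m
... | _ | away a≢m a≢1+m    = swap-other a≢m a≢1+m

swap-injective : ∀ m → Injective _≡_ _≡_ (swap m)
swap-injective m {a} {b} sa≡sb = begin
  a                  ≡⟨ sym (swap-involutive m a) ⟩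
  swap m (swap m a)  ≡⟨ cong (swap m) sa≡sb ⟩
  swap m (swap m b)  ≡⟨ swap-involutive m b ⟩
  b                  ∎
  where open ≡-Reasoning

swap-suc : ∀ m k → swap (suc m) (suc k) ≡ suc (swap m k)
swap-suc m k with k ≡ᵇ m
... | true = refl
... | false with k ≡ᵇ suc m
...   | true = refl
...   | false = refl

swap-<ᵇ : ∀ {m i j} → ¬ (i ≡ m × j ≡ suc m) → ¬ (i ≡ suc m × j ≡ m)
        → (swap m i <ᵇ swap m j) ≡ (i <ᵇ j)
swap-<ᵇ {m} {i} {j} ¬m,1+m ¬1+m,m with swap m i | swap-view m i | swap m j | swap-view m j
... | _ | at-m   | _ | at-m           = refl
... | _ | at-m   | _ | at-1+m         = ⊥-elim (¬m,1+m (refl , refl))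
... | _ | at-m   | _ | away j≢m j≢1+m = <ᵇ-suc-left j≢1+m
... | _ | at-1+m | _ | at-m           = ⊥-elim (¬1+m,m (refl , refl))
... | _ | at-1+m | _ | at-1+m         = refl
... | _ | at-1+m | _ | away j≢m j≢1+m = sym (<ᵇ-suc-left j≢1+m)
... | _ | away i≢m i≢1+m | _ | at-m   = <ᵇ-suc-right i≢m
... | _ | away i≢m i≢1+m | _ | at-1+m = sym (<ᵇ-suc-right i≢m)
... | _ | away _ _ | _ | away _ _     = refl

sumTo : (ℕ → ℕ) → ℕ → ℕ
sumTo F zero    = 0
sumTo F (suc n) = sumTo F n + F (suc n)

sum-map-range1 : ∀ F n → sum (map F (range1 n)) ≡ sumTo F n
sum-map-range1 F zero    = refl
sum-map-range1 F (suc n) = begin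
  sum (map F (map suc (upTo (suc n))))
    ≡⟨ cong (λ xs → sum (map F (map suc xs))) (sym (upTo-∷ʳ n)) ⟩
  sum (map F (map suc (upTo n ++ n ∷ [])))
    ≡⟨ cong (sum ∘ map F) (map-++ suc (upTo n) (n ∷ [])) ⟩
  sum (map F (range1 n ++ suc n ∷ []))
    ≡⟨ cong sum (map-++ F (range1 n) (suc n ∷ [])) ⟩
  sum (map F (range1 n) ++ F (suc n) ∷ [])
    ≡⟨ sum-++ (map F (range1 n)) (F (suc n) ∷ []) ⟩
  sum (map F (range1 n)) + (F (suc n) + 0)
    ≡⟨ cong₂ _+_ (sum-map-range1 F n) (+-identityʳ _) ⟩
  sumTo F n + F (suc n) ∎
  where open ≡-Reasoning

sumTo-cong : ∀ {F G} n → (∀ {a} → 1 ≤ a → a ≤ n → F a ≡ G a) → sumTo F n ≡ sumTo G n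
sumTo-cong zero    F≗G = refl
sumTo-cong (suc n) F≗G =
  cong₂ _+_ (sumTo-cong n (λ 1≤a a≤n → F≗G 1≤a (m≤n⇒m≤1+n a≤n))) (F≗G z<s ≤-refl)

sumTo-exchange : ∀ {F G} n {m} → 1 ≤ m → m ≤ n
               → (∀ {a} → 1 ≤ a → a ≤ n → a ≢ m → F a ≡ G a)
               → sumTo F n + G m ≡ sumTo G n + F m
sumTo-exchange zero (s≤s _) ()
sumTo-exchange {F} {G} (suc n) {m} 1≤m m≤1+n agree with m≤n⇒m<n∨m≡n m≤1+n
... | inj₂ refl = begin
  sumTo F n + F (suc n) + G (suc n) ≡⟨ cong (λ x → x + F (suc n) + G (suc n)) below ⟩
  sumTo G n + F (suc n) + G (suc n) ≡⟨ xy∙z≈xz∙y (sumTo G n) _ _ ⟩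
  sumTo G n + G (suc n) + F (suc n) ∎
  where
  open ≡-Reasoning
  below : sumTo F n ≡ sumTo G n
  below = sumTo-cong n (λ 1≤a a≤n → agree 1≤a (m≤n⇒m≤1+n a≤n) (<⇒≢ (s≤s a≤n)))
... | inj₁ (s≤s m≤n) = begin
  sumTo F n + F (suc n) + G m ≡⟨ xy∙z≈xz∙y (sumTo F n) _ _ ⟩
  sumTo F n + G m + F (suc n) ≡⟨ cong₂ _+_ IH (agree z<s ≤-refl (<⇒≢ (s≤s m≤n) ∘ sym)) ⟩
  sumTo G n + F m + G (suc n) ≡⟨ xy∙z≈xz∙y (sumTo G n) _ _ ⟩
  sumTo G n + G (suc n) + F m ∎
  where
  open ≡-Reasoning
  IH : sumTo F n + G m ≡ sumTo G n + F m
  IH = sumTo-exchange n 1≤m m≤n (λ 1≤a a≤n → agree 1≤a (m≤n⇒m≤1+n a≤n))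

sumTo-∘swap : ∀ F n {m} → 1 ≤ m → m < n → sumTo (F ∘ swap m) n ≡ sumTo F n
sumTo-∘swap F (suc n) {m} 1≤m (s≤s m≤n) with m≤n⇒m<n∨m≡n m≤n
... | inj₁ m<n = cong₂ _+_ (sumTo-∘swap F n 1≤m m<n)
                           (cong F (swap-other (<⇒≢ (m<n⇒m<1+n m<n) ∘ sym) (<⇒≢ (s≤s m<n) ∘ sym)))
... | inj₂ refl with 1≤m
...   | s≤s {n = m′} _ = begin
  sumTo (F ∘ swap m) m′ + F (swap m m) + F (swap m (suc m))
    ≡⟨ cong₂ (λ x y → x + y + F (swap m (suc m))) fixed-below (cong F (swap-same m)) ⟩
  sumTo F m′ + F (suc m) + F (swap m (suc m))
    ≡⟨ cong (λ x → sumTo F m′ + F (suc m) + F x) (swap-suc-same m) ⟩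
  sumTo F m′ + F (suc m) + F m
    ≡⟨ xy∙z≈xz∙y (sumTo F m′) _ _ ⟩
  sumTo F m′ + F m + F (suc m) ∎
  where
  open ≡-Reasoning
  fixed-below : sumTo (F ∘ swap m) m′ ≡ sumTo F m′
  fixed-below = sumTo-cong m′ (λ _ a≤m′ →
    cong F (swap-other (<⇒≢ (s≤s a≤m′)) (<⇒≢ (m<n⇒m<1+n (s≤s a≤m′)))))

inversion : (ℕ → ℕ) → ℕ → ℕ → ℕ
inversion v i j = if (i <ᵇ j) ∧ (v j <ᵇ v i) then 1 else 0

sum-concatMap : ∀ (f : ℕ → List ℕ) xs → sum (concatMap f xs) ≡ sum (map (sum ∘ f) xs)
sum-concatMap f []       = refl
sum-concatMap f (x ∷ xs) = trans (sum-++ (f x) (concatMap f xs)) (cong (sum (f x) +_) (sum-concatMap f xs))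

len≡sumTo : ∀ n v → len n v ≡ sumTo (λ i → sumTo (inversion v i) n) n
len≡sumTo n v = begin
  len n v                                         ≡⟨ sum-concatMap _ (range1 n) ⟩
  sum (map (λ i → sum (map (inversion v i) (range1 n))) (range1 n))
    ≡⟨ cong sum (map-cong (λ i → sum-map-range1 (inversion v i) n) (range1 n)) ⟩
  sum (map (λ i → sumTo (inversion v i) n) (range1 n)) ≡⟨ sum-map-range1 _ n ⟩
  sumTo (λ i → sumTo (inversion v i) n) n         ∎
  where open ≡-Reasoning

len-cong : ∀ n {v u} → v ≗ u → len n v ≡ len n u
len-cong n {v} {u} v≗u = begin
  len n v                                  ≡⟨ len≡sumTo n v ⟩
  sumTo (λ i → sumTo (inversion v i) n) n
    ≡⟨ sumTo-cong n (λ {i} _ _ → sumTo-cong n (λ {j} _ _ → inversion-cong i j)) ⟩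
  sumTo (λ i → sumTo (inversion u i) n) n  ≡⟨ sym (len≡sumTo n u) ⟩
  len n u                                  ∎
  where
  open ≡-Reasoning
  inversion-cong : ∀ i j → inversion v i j ≡ inversion u i j
  inversion-cong i j rewrite v≗u i | v≗u j = refl

-- Reindexing the double sum by s_m leaves every inversion indicator unchanged except that of
-- the pair (m+1, m), which is switched on.
len-∘swap-ascent : ∀ n {v m} → 1 ≤ m → m < n → v m < v (suc m) → len n (v ∘ swap m) ≡ suc (len n v)
len-∘swap-ascent n {v} {m} 1≤m m<n vm<vm+1 = +-cancelʳ-≡ (row (suc m)) _ _ (begin
  len n (v ∘ s) + row (suc m)        ≡⟨ cong (_+ row (suc m)) len-twisted ⟩
  sumTo twistedRow n + row (suc m)   ≡⟨ sumTo-exchange n z<s m<n (λ _ _ → twistedRow-other) ⟩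
  sumTo row n + twistedRow (suc m)   ≡⟨ cong (sumTo row n +_) twistedRow-1+m ⟩
  sumTo row n + suc (row (suc m))    ≡⟨ +-suc (sumTo row n) _ ⟩
  suc (sumTo row n + row (suc m))    ≡⟨ cong (λ x → suc x + row (suc m)) (sym (len≡sumTo n v)) ⟩
  suc (len n v) + row (suc m)        ∎)
  where
  open ≡-Reasoning
  s = swap m
  twisted : ℕ → ℕ → ℕ
  twisted i j = if (s i <ᵇ s j) ∧ (v j <ᵇ v i) then 1 else 0
  row twistedRow : ℕ → ℕ
  row i = sumTo (inversion v i) n
  twistedRow i = sumTo (twisted i) n
  len-twisted : len n (v ∘ s) ≡ sumTo twistedRow n
  len-twisted = begin
    len n (v ∘ s)
      ≡⟨ len≡sumTo n (v ∘ s) ⟩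
    sumTo (λ i → sumTo (inversion (v ∘ s) i) n) n
      ≡⟨ sym (sumTo-∘swap _ n 1≤m m<n) ⟩
    sumTo (λ i → sumTo (inversion (v ∘ s) (s i)) n) n
      ≡⟨ sumTo-cong n (λ _ _ → sym (sumTo-∘swap _ n 1≤m m<n)) ⟩
    sumTo (λ i → sumTo (λ j → inversion (v ∘ s) (s i) (s j)) n) n
      ≡⟨ sumTo-cong n (λ {i} _ _ → sumTo-cong n (λ {j} _ _ →
           cong₂ (λ x y → if (s i <ᵇ s j) ∧ (v y <ᵇ v x) then 1 else 0) (swap-involutive m i) (swap-involutive m j))) ⟩
    sumTo twistedRow n ∎
  twisted-other : ∀ {i j} → i ≢ suc m → twisted i j ≡ inversion v i j
  twisted-other {i} {j} i≢1+m with i ≟ m | j ≟ suc m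
  ... | yes refl | yes refl
    rewrite swap-same m | swap-suc-same m | dec-false (suc m <? m) (<-asym (n<1+n m))
          | dec-true (m <? suc m) (n<1+n m) | dec-false (v (suc m) <? v m) (<-asym vm<vm+1) = refl
  ... | yes refl | no j≢1+m rewrite swap-<ᵇ {m} {m} {j} (j≢1+m ∘ proj₂) (i≢1+m ∘ proj₁) = refl
  ... | no i≢m   | _        rewrite swap-<ᵇ {m} {i} {j} (i≢m ∘ proj₁) (i≢1+m ∘ proj₁) = refl
  twistedRow-other : ∀ {i} → i ≢ suc m → twistedRow i ≡ row i
  twistedRow-other i≢1+m = sumTo-cong n (λ _ _ → twisted-other i≢1+m)
  twistedRow-1+m : twistedRow (suc m) ≡ suc (row (suc m))
  twistedRow-1+m = begin
    twistedRow (suc m)                         ≡⟨ sym (+-identityʳ _) ⟩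
    twistedRow (suc m) + 0                     ≡⟨ cong (twistedRow (suc m) +_) (sym inversion-1+m-m) ⟩
    twistedRow (suc m) + inversion v (suc m) m ≡⟨ sumTo-exchange n 1≤m (<⇒≤ m<n) (λ _ _ → twisted-1+m) ⟩
    row (suc m) + twisted (suc m) m            ≡⟨ cong (row (suc m) +_) twisted-1+m-m ⟩
    row (suc m) + 1                            ≡⟨ +-comm (row (suc m)) 1 ⟩
    suc (row (suc m))                          ∎
    where
    twisted-1+m : ∀ {j} → j ≢ m → twisted (suc m) j ≡ inversion v (suc m) j
    twisted-1+m {j} j≢m rewrite swap-<ᵇ {m} {suc m} {j} (1+n≢n ∘ proj₁) (j≢m ∘ proj₂) = refl
    inversion-1+m-m : inversion v (suc m) m ≡ 0
    inversion-1+m-m rewrite dec-false (suc m <? m) (<-asym (n<1+n m)) = refl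
    twisted-1+m-m : twisted (suc m) m ≡ 1
    twisted-1+m-m rewrite swap-same m | swap-suc-same m | dec-true (m <? suc m) (n<1+n m)
                        | dec-true (v m <? v (suc m)) vm<vm+1 = refl

len-∘swap-descent : ∀ n {v m} → Injective _≡_ _≡_ v → 1 ≤ m → m < n → ¬ v m < v (suc m)
                  → len n v ≡ suc (len n (v ∘ swap m))
len-∘swap-descent n {v} {m} v-inj 1≤m m<n ¬asc =
  trans (len-cong n (λ k → cong v (sym (swap-involutive m k))))
        (len-∘swap-ascent n {v ∘ swap m} 1≤m m<n u-asc)
  where
  u-asc : v (swap m m) < v (swap m (suc m))
  u-asc rewrite swap-same m | swap-suc-same m = ≤∧≢⇒< (≮⇒≥ ¬asc) (1+n≢n ∘ v-inj)

-- The Demazure product on injective functions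

-- v * τ_m with the length test replaced by the ascent test; by demStep≗*τ they agree on injective v.
_*τ_ : (ℕ → ℕ) → ℕ → ℕ → ℕ
(v *τ m) with v m <? v (suc m)
... | yes _ = v ∘ swap m
... | no  _ = v

*τ-ascent : ∀ {v m} → v m < v (suc m) → v *τ m ≗ v ∘ swap m
*τ-ascent {v} {m} asc k with v m <? v (suc m)
... | yes _   = refl
... | no ¬asc = ⊥-elim (¬asc asc)

*τ-fixes : ∀ {v m a} → a ≢ m → a ≢ suc m → (v *τ m) a ≡ v a
*τ-fixes {v} {m} a≢m a≢1+m with v m <? v (suc m)
... | yes _ = cong v (swap-other a≢m a≢1+m)
... | no  _ = refl

*τ-cong : ∀ {v u} m → v ≗ u → v *τ m ≗ u *τ m
*τ-cong {v} {u} m v≗u k with v m <? v (suc m) | u m <? u (suc m)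
... | yes _   | yes _   = v≗u (swap m k)
... | no  _   | no  _   = v≗u k
... | yes asc | no ¬asc = ⊥-elim (¬asc (subst₂ _<_ (v≗u m) (v≗u (suc m)) asc))
... | no ¬asc | yes asc = ⊥-elim (¬asc (subst₂ _<_ (sym (v≗u m)) (sym (v≗u (suc m))) asc))

*τ-injective : ∀ {v} m → Injective _≡_ _≡_ v → Injective _≡_ _≡_ (v *τ m)
*τ-injective {v} m v-inj with v m <? v (suc m)
... | yes _ = swap-injective m ∘ v-inj
... | no  _ = v-inj

demStep≗*τ : ∀ n {v m} → Injective _≡_ _≡_ v → 1 ≤ m → m < n → demStep n v m ≗ v *τ m
demStep≗*τ n {v} {m} v-inj 1≤m m<n k with v m <? v (suc m)
... | yes asc rewrite dec-true (len n v <? len n (v ∘ swap m))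
                               (≤-reflexive (sym (len-∘swap-ascent n {v} 1≤m m<n asc))) = refl
... | no ¬asc rewrite dec-false (len n v <? len n (v ∘ swap m))
        (λ lt → <-asym lt (≤-reflexive (sym (len-∘swap-descent n {v} v-inj 1≤m m<n ¬asc)))) = refl

foldl-*τ-injective : ∀ {v} ws → Injective _≡_ _≡_ v → Injective _≡_ _≡_ (foldl _*τ_ v ws)
foldl-*τ-injective []       v-inj = v-inj
foldl-*τ-injective (m ∷ ws) v-inj = foldl-*τ-injective ws (*τ-injective m v-inj)

foldl-demStep≗foldl-*τ : ∀ n {v u} ws → v ≗ u → Injective _≡_ _≡_ u
                       → All (λ m → 1 ≤ m × m < n) ws
                       → foldl (demStep n) v ws ≗ foldl _*τ_ u ws
foldl-demStep≗foldl-*τ n []       v≗u u-inj []                  = v≗u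
foldl-demStep≗foldl-*τ n {v} {u} (m ∷ ws) v≗u u-inj ((1≤m , m<n) ∷ ms) =
  foldl-demStep≗foldl-*τ n ws step (*τ-injective m u-inj) ms
  where
  step : demStep n v m ≗ u *τ m
  step k = trans (demStep≗*τ n {v} (λ eq → u-inj (trans (sym (v≗u _)) (trans eq (v≗u _)))) 1≤m m<n k)
                 (*τ-cong m v≗u k)

foldl-*τ-fixes-below : ∀ {v s a} ws → All (s ≤_) ws → a < s → foldl _*τ_ v ws a ≡ v a
foldl-*τ-fixes-below []       []           a<s = refl
foldl-*τ-fixes-below {v} (m ∷ ws) (s≤m ∷ s≤ws) a<s =
  trans (foldl-*τ-fixes-below ws s≤ws a<s)
        (*τ-fixes {v} (<⇒≢ (<-≤-trans a<s s≤m)) (<⇒≢ (<-≤-trans a<s (m≤n⇒m≤1+n s≤m))))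

injective⇒positive : ∀ {v a} → Injective _≡_ _≡_ v → v 0 ≡ 0 → 1 ≤ a → 1 ≤ v a
injective⇒positive v-inj v0≡0 (s≤s _) = n≢0⇒n>0 (λ va≡0 → 1+n≢0 (v-inj (trans va≡0 (sym v0≡0))))

shift : (ℕ → ℕ) → ℕ → ℕ
shift v zero    = zero
shift v (suc k) = suc (v k)

*τ-shift : ∀ v m → shift v *τ suc m ≗ shift (v *τ m)
*τ-shift v m k with v m <? v (suc m) | suc (v m) <? suc (v (suc m))
... | yes _   | yes _   = shift-∘swap k
  where
  shift-∘swap : ∀ k → shift v (swap (suc m) k) ≡ shift (v ∘ swap m) k
  shift-∘swap zero    = refl
  shift-∘swap (suc k) = cong (shift v) (swap-suc m k)
... | no  _   | no  _   = refl
... | yes asc | no ¬asc = ⊥-elim (¬asc (s≤s asc))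
... | no ¬asc | yes asc = ⊥-elim (¬asc (≤-pred asc))

foldl-*τ-shift : ∀ {u v} ws → u ≗ shift v → foldl _*τ_ u (map suc ws) ≗ shift (foldl _*τ_ v ws)
foldl-*τ-shift []       u≗v = u≗v
foldl-*τ-shift {u} {v} (m ∷ ws) u≗v =
  foldl-*τ-shift ws (λ k → trans (*τ-cong (suc m) u≗v k) (*τ-shift v m k))

interval : ℕ → ℕ → List ℕ
interval t zero    = []
interval t (suc c) = t ∷ interval (suc t) c

interval-≥ : ∀ t c → All (t ≤_) (interval t c)
interval-≥ t zero    = []
interval-≥ t (suc c) = ≤-refl ∷ All.map <⇒≤ (interval-≥ (suc t) c)

map-suc-interval : ∀ t c → map suc (interval t c) ≡ interval (suc t) c
map-suc-interval t zero    = refl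
map-suc-interval t (suc c) = cong (suc t ∷_) (map-suc-interval (suc t) c)

range1≡interval : ∀ n → range1 n ≡ interval 1 n
range1≡interval n = trans (cong (map suc) (upTo≡interval n)) (map-suc-interval 0 n)
  where
  upTo≡interval : ∀ c → upTo c ≡ interval 0 c
  upTo≡interval zero    = refl
  upTo≡interval (suc c) = cong (0 ∷_) (begin
    applyUpTo suc c         ≡⟨ sym (map-applyUpTo id suc c) ⟩
    map suc (upTo c)        ≡⟨ cong (map suc) (upTo≡interval c) ⟩
    map suc (interval 0 c)  ≡⟨ map-suc-interval 0 c ⟩
    interval 1 c            ∎)
    where open ≡-Reasoning

concatMap⁺ : ∀ {R : ℕ → Set} (f : ℕ → List ℕ) xs → (∀ x → All R (f x)) → All R (concatMap f xs)
concatMap⁺ f []       fR = []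
concatMap⁺ f (x ∷ xs) fR = ++⁺ (fR x) (concatMap⁺ f xs fR)

concatMap-if≡filterᵇ : ∀ (Q : ℕ → Bool) (f : ℕ → ℕ) → (∀ i → f i ≡ i) → ∀ xs
                     → concatMap (λ i → if Q i then f i ∷ [] else []) xs ≡ filterᵇ Q xs
concatMap-if≡filterᵇ Q f f≗id []       = refl
concatMap-if≡filterᵇ Q f f≗id (x ∷ xs) with Q x
... | true  = cong₂ _∷_ (f≗id x) (concatMap-if≡filterᵇ Q f f≗id xs)
... | false = concatMap-if≡filterᵇ Q f f≗id xs

dropFirstColumn : (ℕ → ℕ → Bool) → ℕ → ℕ → Bool
dropFirstColumn P i zero    = false
dropFirstColumn P i (suc j) = P i (suc (suc j))

IsPipeDream-dropFirstColumn : ∀ n P → IsPipeDream (suc n) P → IsPipeDream n (dropFirstColumn P)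
IsPipeDream-dropFirstColumn n P pd i (suc j) Pij with pd i (suc (suc j)) Pij
... | 1≤i , _ , i+j+2≤n+1 = 1≤i , z<s , ≤-pred (subst (_≤ suc n) (+-suc i (suc j)) i+j+2≤n+1)

columnWord : ℕ → (ℕ → ℕ → Bool) → ℕ → List ℕ
columnWord n P j = concatMap (λ i → if P i j then (i + j ∸ 1) ∷ [] else []) (range1 (n ∸ j))

columnWord-suc : ∀ n P j → columnWord (suc (suc n)) P (suc (suc j))
                           ≡ map suc (columnWord (suc n) (dropFirstColumn P) (suc j))
columnWord-suc n P j = sym (trans (map-concatMap suc _ (range1 (n ∸ j))) (concatMap-cong letter (range1 (n ∸ j))))
  where
  letter : ∀ i → map suc (if P i (suc (suc j)) then (i + suc j ∸ 1) ∷ [] else [])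
               ≡ (if P i (suc (suc j)) then (i + suc (suc j) ∸ 1) ∷ [] else [])
  letter i with P i (suc (suc j))
  ... | true  rewrite +-suc i (suc j) | +-suc i j = refl
  ... | false = refl

firstColumnWord : ∀ n P → columnWord (suc n) P 1 ≡ filterᵇ (λ i → P i 1) (interval 1 n)
firstColumnWord n P =
  trans (concatMap-if≡filterᵇ (λ i → P i 1) (λ i → i + 1 ∸ 1) (λ i → m+n∸n≡m i 1) (range1 n))
        (cong (filterᵇ (λ i → P i 1)) (range1≡interval n))

concatMap-reverse-map : ∀ (f : ℕ → List ℕ) (g : ℕ → ℕ) xs
                      → concatMap f (reverse (map g xs)) ≡ concatMap (f ∘ g) (reverse xs)
concatMap-reverse-map f g xs = trans (cong (concatMap f) (sym (reverse-map g xs))) (concatMap-map f g (reverse xs))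

pipeWord-suc : ∀ n P → pipeWord (suc n) P ≡ map suc (pipeWord n (dropFirstColumn P)) ++ columnWord (suc n) P 1
pipeWord-suc zero    P = refl
pipeWord-suc (suc n) P = begin
  concatMap col (reverse (range1 (suc n)))
    ≡⟨ cong (λ xs → concatMap col (reverse (1 ∷ map suc xs))) (sym (map-applyUpTo id suc n)) ⟩
  concatMap col (reverse (1 ∷ map suc (range1 n)))
    ≡⟨ cong (concatMap col) (unfold-reverse 1 (map suc (range1 n))) ⟩
  concatMap col (reverse (map suc (range1 n)) ++ 1 ∷ [])
    ≡⟨ concatMap-++ col (reverse (map suc (range1 n))) (1 ∷ []) ⟩
  concatMap col (reverse (map suc (range1 n))) ++ col 1 ++ []
    ≡⟨ cong₂ _++_ later-columns (++-identityʳ (col 1)) ⟩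
  map suc (concatMap col′ (reverse (range1 n))) ++ col 1 ∎
  where
  open ≡-Reasoning
  col col′ : ℕ → List ℕ
  col  = columnWord (suc (suc n)) P
  col′ = columnWord (suc n) (dropFirstColumn P)
  later-columns : concatMap col (reverse (map suc (map suc (upTo n))))
                ≡ map suc (concatMap col′ (reverse (map suc (upTo n))))
  later-columns = begin
    concatMap col (reverse (map suc (map suc (upTo n))))
      ≡⟨ cong (concatMap col ∘ reverse) (sym (map-∘ {g = suc} {f = suc} (upTo n))) ⟩
    concatMap col (reverse (map (suc ∘ suc) (upTo n)))
      ≡⟨ concatMap-reverse-map col (suc ∘ suc) (upTo n) ⟩
    concatMap (col ∘ suc ∘ suc) (reverse (upTo n))
      ≡⟨ concatMap-cong (columnWord-suc n P) (reverse (upTo n)) ⟩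
    concatMap (map suc ∘ col′ ∘ suc) (reverse (upTo n))
      ≡⟨ sym (map-concatMap suc (col′ ∘ suc) (reverse (upTo n))) ⟩
    map suc (concatMap (col′ ∘ suc) (reverse (upTo n)))
      ≡⟨ cong (map suc) (sym (concatMap-reverse-map col′ suc (upTo n))) ⟩
    map suc (concatMap col′ (reverse (map suc (upTo n)))) ∎

pipeWord-letters : ∀ n P → IsPipeDream n P → All (λ m → 1 ≤ m × m < n) (pipeWord n P)
pipeWord-letters n P pd =
  concatMap⁺ _ (reverse (range1 (n ∸ 1))) (λ j → concatMap⁺ _ (range1 (n ∸ j)) (λ i → letter i j))
  where
  letter : ∀ i j → All (λ m → 1 ≤ m × m < n) (if P i j then (i + j ∸ 1) ∷ [] else [])
  letter i j with P i j in Pij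
  ... | false = []
  ... | true with pd i j Pij
  ...   | s≤s {n = i′} _ , 1≤j , i+j≤n = (≤-trans 1≤j (m≤n+m j i′) , i+j≤n) ∷ []

-- The first column of a pipe dream

δ : ℕ → (ℕ → ℕ → Bool) → ℕ → ℕ
δ n P = foldl _*τ_ id (pipeWord n P)

demazure≗δ : ∀ n P → IsPipeDream n P → demazure n (pipeWord n P) ≗ δ n P
demazure≗δ n P pd = foldl-demStep≗foldl-*τ n (pipeWord n P) (λ _ → refl) id (pipeWord-letters n P pd)

δ-injective : ∀ n P → Injective _≡_ _≡_ (δ n P)
δ-injective n P = foldl-*τ-injective (pipeWord n P) id

δ-0 : ∀ n P → IsPipeDream n P → δ n P 0 ≡ 0
δ-0 n P pd = foldl-*τ-fixes-below (pipeWord n P) (All.map proj₁ (pipeWord-letters n P pd)) z<s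

δ-positive : ∀ n P → IsPipeDream n P → ∀ {a} → 1 ≤ a → 1 ≤ δ n P a
δ-positive n P pd = injective⇒positive (δ-injective n P) (δ-0 n P pd)

δ-suc : ∀ n P → δ (suc n) P ≡ foldl _*τ_ (foldl _*τ_ id (map suc (pipeWord n (dropFirstColumn P))))
                                        (filterᵇ (λ i → P i 1) (interval 1 n))
δ-suc n P = begin
  foldl _*τ_ id (pipeWord (suc n) P)
    ≡⟨ cong (foldl _*τ_ id) (pipeWord-suc n P) ⟩
  foldl _*τ_ id (map suc (pipeWord n (dropFirstColumn P)) ++ columnWord (suc n) P 1)
    ≡⟨ foldl-++ _*τ_ id (map suc (pipeWord n (dropFirstColumn P))) (columnWord (suc n) P 1) ⟩
  foldl _*τ_ (foldl _*τ_ id (map suc (pipeWord n (dropFirstColumn P)))) (columnWord (suc n) P 1)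
    ≡⟨ cong (foldl _*τ_ _) (firstColumnWord n P) ⟩
  foldl _*τ_ (foldl _*τ_ id (map suc (pipeWord n (dropFirstColumn P))))
             (filterᵇ (λ i → P i 1) (interval 1 n)) ∎
  where open ≡-Reasoning

-- Multiplying by the crosses t, t+1, … of a column carries the value 1 from position t
-- down to the first position k without a cross, lifting the values in between by one row.
record Bubbled (Q : ℕ → Bool) (t : ℕ) (v W : ℕ → ℕ) : Set where
  field
    k        : ℕ
    t≤k      : t ≤ k
    Q-k      : Q k ≡ false
    Q-run    : ∀ {a} → t ≤ a → a < k → Q a ≡ true
    W-k      : W k ≡ 1
    W-run    : ∀ {a} → t ≤ a → a < k → W a ≡ v (suc a)
    W-before : ∀ {a} → a < t → W a ≡ v a

Bubbled-resp : ∀ {Q t v u W} → v ≗ u → Bubbled Q t v W → Bubbled Q t u W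
Bubbled-resp v≗u B = record
  { k = k ; t≤k = t≤k ; Q-k = Q-k ; Q-run = Q-run ; W-k = W-k
  ; W-run    = λ t≤a a<k → trans (W-run t≤a a<k) (v≗u _)
  ; W-before = λ a<t → trans (W-before a<t) (v≗u _)
  }
  where open Bubbled B

Bubbled-stop : ∀ {Q t v W} → Q t ≡ false → W t ≡ 1 → (∀ {a} → a < t → W a ≡ v a)
             → Bubbled Q t v W
Bubbled-stop {t = t} Qt W-t W-before = record
  { k = t ; t≤k = ≤-refl ; Q-k = Qt ; W-k = W-t ; W-before = W-before
  ; Q-run = λ t≤a a<t → ⊥-elim (<⇒≱ a<t t≤a)
  ; W-run = λ t≤a a<t → ⊥-elim (<⇒≱ a<t t≤a)
  }

Bubbled-swap : ∀ {Q t v W} → Q t ≡ true → Bubbled Q (suc t) (v ∘ swap t) W → Bubbled Q t v W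
Bubbled-swap {Q} {t} {v} {W} Qt B = record
  { k = k ; t≤k = <⇒≤ t≤k ; Q-k = Q-k ; W-k = W-k ; Q-run = Q-run′ ; W-run = W-run′
  ; W-before = λ a<t → trans (W-before (m<n⇒m<1+n a<t))
                             (cong v (swap-other (<⇒≢ a<t) (<⇒≢ (m<n⇒m<1+n a<t))))
  }
  where
  open Bubbled B
  Q-run′ : ∀ {a} → t ≤ a → a < k → Q a ≡ true
  Q-run′ {a} t≤a a<k with t ≟ a
  ... | yes refl = Qt
  ... | no t≢a   = Q-run (≤∧≢⇒< t≤a t≢a) a<k
  W-run′ : ∀ {a} → t ≤ a → a < k → W a ≡ v (suc a)
  W-run′ {a} t≤a a<k with t ≟ a
  ... | yes refl = trans (W-before (n<1+n t)) (cong v (swap-same t))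
  ... | no t≢a   = trans (W-run t<a a<k)
                         (cong v (swap-other (<⇒≢ (m<n⇒m<1+n t<a) ∘ sym) (<⇒≢ (s≤s t<a) ∘ sym)))
    where t<a = ≤∧≢⇒< t≤a t≢a

bubble : ∀ Q c {t v} → Q (t + c) ≡ false → v t ≡ 1 → (∀ {a} → t < a → 1 < v a)
       → Bubbled Q t v (foldl _*τ_ v (filterᵇ Q (interval t c)))
bubble Q zero {t} Qt+0 vt≡1 _ =
  Bubbled-stop (subst (λ x → Q x ≡ false) (+-identityʳ t) Qt+0) vt≡1 (λ _ → refl)
bubble Q (suc c) {t} {v} Qend vt≡1 v>1 with Q t in Qt
... | false = Bubbled-stop Qt (trans (later-fix (n<1+n t)) vt≡1) (later-fix ∘ m<n⇒m<1+n)
  where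
  later-fix : ∀ {a} → a < suc t → foldl _*τ_ v (filterᵇ Q (interval (suc t) c)) a ≡ v a
  later-fix = foldl-*τ-fixes-below _ (filter⁺ (T? ∘ Q) (interval-≥ (suc t) c))
... | true = Bubbled-swap Qt (Bubbled-resp swapped (bubble Q c Qend′ v′t+1≡1 v′>1))
  where
  swapped : v *τ t ≗ v ∘ swap t
  swapped = *τ-ascent {v} (subst (_< v (suc t)) (sym vt≡1) (v>1 (n<1+n t)))
  Qend′ : Q (suc t + c) ≡ false
  Qend′ = trans (cong Q (sym (+-suc t c))) Qend
  v′t+1≡1 : (v *τ t) (suc t) ≡ 1
  v′t+1≡1 = trans (swapped (suc t)) (trans (cong v (swap-suc-same t)) vt≡1)
  v′>1 : ∀ {a} → suc t < a → 1 < (v *τ t) a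
  v′>1 {a} t+1<a = subst (1 <_) (sym (trans (swapped a) (cong v (swap-other (<⇒≢ t<a ∘ sym) (<⇒≢ t+1<a ∘ sym)))))
                         (v>1 t<a)
    where t<a = <-trans (n<1+n t) t+1<a

firstColumn-bubbled : ∀ n P → IsPipeDream (suc n) P
            → Bubbled (λ i → P i 1) 1 (shift (δ n (dropFirstColumn P))) (δ (suc n) P)
firstColumn-bubbled n P pd = subst (Bubbled (λ i → P i 1) 1 (shift W′)) (sym (δ-suc n P))
                           (Bubbled-resp u≗shift (bubble (λ i → P i 1) n P-end u1≡1 u>1))
  where
  P′  = dropFirstColumn P
  pd′ = IsPipeDream-dropFirstColumn n P pd
  W′  = δ n P′
  u   = foldl _*τ_ id (map suc (pipeWord n P′))
  u≗shift : u ≗ shift W′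
  u≗shift = foldl-*τ-shift (pipeWord n P′) (λ { zero → refl ; (suc _) → refl })
  P-end : P (1 + n) 1 ≡ false
  P-end with P (suc n) 1 in Pn1
  ... | false = refl
  ... | true with pd (suc n) 1 Pn1
  ...   | _ , _ , n+2≤n+1 = ⊥-elim (1+n≰n (subst (_≤ suc n) (+-comm (suc n) 1) n+2≤n+1))
  u1≡1 : u 1 ≡ 1
  u1≡1 = trans (u≗shift 1) (cong suc (δ-0 n P′ pd′))
  u>1 : ∀ {a} → 1 < a → 1 < u a
  u>1 {suc a} (s≤s 1≤a) = subst (1 <_) (sym (u≗shift (suc a))) (s≤s (δ-positive n P′ pd′ 1≤a))

-- Dominant cells

_≐_ : Cells → Cells → Set
U ≐ V = U ⊆ V × V ⊆ U

≐-trans : ∀ {U V X} → U ≐ V → V ≐ X → U ≐ X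
≐-trans (U⊆V , V⊆U) (V⊆X , X⊆V) = (λ i j → V⊆X i j ∘ U⊆V i j) ,
                                  (λ i j → V⊆U i j ∘ X⊆V i j)

-- For a permutation W this is dom(W), by Young≐dominant.
dominant : (ℕ → ℕ) → Cells
dominant W i j = 1 ≤ i × 1 ≤ j × (∀ {a} → 1 ≤ a → a ≤ i → j < W a)

AddableCell : Cells → Cells
AddableCell U i j = 1 ≤ i × 1 ≤ j × ¬ U i j × (1 < i → U (i ∸ 1) j) × (1 < j → U i (j ∸ 1))

AddableCell-resp : ∀ {U V} → U ≐ V → AddableCell U ⊆ AddableCell V
AddableCell-resp (U⊆V , V⊆U) i j (1≤i , 1≤j , ¬U , up , left) =
  1≤i , 1≤j , ¬U ∘ V⊆U i j , U⊆V _ _ ∘ up , U⊆V _ _ ∘ left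

dominant-cong : ∀ {W V} → W ≗ V → dominant W ≐ dominant V
dominant-cong W≗V = transport W≗V , transport (sym ∘ W≗V)
  where
  transport : ∀ {W V} → W ≗ V → dominant W ⊆ dominant V
  transport W≗V i j (1≤i , 1≤j , below) =
    1≤i , 1≤j , λ 1≤a a≤i → subst (j <_) (W≗V _) (below 1≤a a≤i)

dominant-extend : ∀ {W i j} → 1 ≤ i → 1 ≤ j → (1 < i → dominant W (i ∸ 1) j) → j < W i
                → dominant W i j
dominant-extend {W} {i} {j} 1≤i 1≤j up j<Wi = 1≤i , 1≤j , below
  where
  below : ∀ {a} → 1 ≤ a → a ≤ i → j < W a
  below {a} 1≤a a≤i with a ≟ i
  ... | yes refl = j<Wi
  ... | no a≢i with ≤∧≢⇒< a≤i a≢i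
  ...   | s≤s a≤i-1 = proj₂ (proj₂ (up (<-≤-trans (s≤s 1≤a) (s≤s a≤i-1)))) 1≤a a≤i-1

addable-dominant⇒≡ : ∀ {W} → (∀ {a} → 1 ≤ a → 1 ≤ W a)
                   → ∀ i j → AddableCell (dominant W) i j → j ≡ W i
addable-dominant⇒≡ {W} W-pos i j (1≤i , 1≤j , ¬d , up , left) =
  ≤-antisym (j≤Wi j 1≤j left) (≮⇒≥ (¬d ∘ dominant-extend 1≤i 1≤j up))
  where
  j≤Wi : ∀ j → 1 ≤ j → (1 < j → dominant W i (j ∸ 1)) → j ≤ W i
  j≤Wi (suc zero)    _ _    = W-pos 1≤i
  j≤Wi (suc (suc j)) _ left = proj₂ (proj₂ (left (s≤s z<s))) 1≤i ≤-refl

module FirstColumnCells {P : ℕ → ℕ → Bool} {W W′ : ℕ → ℕ}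
                        (B : Bubbled (λ i → P i 1) 1 (shift W′) W)
                        (W′-pos : ∀ {a} → 1 ≤ a → 1 ≤ W′ a) where
  open Bubbled B public using (k; Q-k; Q-run) renaming (t≤k to 1≤k)
  open Bubbled B using (W-k; W-run)

  dominant⇒<k : ∀ {i j} → dominant W i j → i < k
  dominant⇒<k {i} (1≤i , 1≤j , below) with k ≤? i
  ... | yes k≤i = ⊥-elim (<⇒≱ (subst (_ <_) W-k (below 1≤k k≤i)) 1≤j)
  ... | no k≰i  = ≰⇒> k≰i

  dominant-1 : ∀ {i} → 1 ≤ i → i < k → dominant W i 1
  dominant-1 1≤i i<k = 1≤i , ≤-refl , λ 1≤a a≤i →
    subst (1 <_) (sym (W-run 1≤a (≤-<-trans a≤i i<k))) (s≤s (W′-pos 1≤a))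

  dominant-suc⁻ : ∀ {i j} → dominant W i (suc j) → 1 ≤ j → dominant W′ i j
  dominant-suc⁻ d@(1≤i , _ , below) 1≤j = 1≤i , 1≤j , λ 1≤a a≤i →
    ≤-pred (subst (_ <_) (W-run 1≤a (≤-<-trans a≤i (dominant⇒<k d))) (below 1≤a a≤i))

  dominant-suc⁺ : ∀ {i j} → i < k → dominant W′ i j → dominant W i (suc j)
  dominant-suc⁺ i<k (1≤i , _ , below) = 1≤i , z<s , λ 1≤a a≤i →
    subst (_ <_) (sym (W-run 1≤a (≤-<-trans a≤i i<k))) (s≤s (below 1≤a a≤i))

dominant-δ⊆ : ∀ n P → IsPipeDream n P → dominant (δ n P) ⊆ cellsOf P
dominant-δ⊆ zero    P pd i j (1≤i , 1≤j , below) = ⊥-elim (<⇒≱ (below ≤-refl 1≤i) 1≤j)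
dominant-δ⊆ (suc n) P pd = dominant-⊆
  where
  pd′ = IsPipeDream-dropFirstColumn n P pd
  open FirstColumnCells {P} (firstColumn-bubbled n P pd) (δ-positive n (dropFirstColumn P) pd′)
  dominant-⊆ : dominant (δ (suc n) P) ⊆ cellsOf P
  dominant-⊆ i zero          (_ , () , _)
  dominant-⊆ i (suc zero)    d = Q-run (proj₁ d) (dominant⇒<k d)
  dominant-⊆ i (suc (suc j)) d = dominant-δ⊆ n (dropFirstColumn P) pd′ i (suc j) (dominant-suc⁻ d z<s)

addable-dominant-δ∉ : ∀ n P → IsPipeDream n P
                    → ∀ i j → AddableCell (dominant (δ n P)) i j → ¬ cellsOf P i j
addable-dominant-δ∉ zero P pd i j _ Pij with pd i j Pij
... | s≤s _ , _ , ()
addable-dominant-δ∉ (suc n) P pd = addable-∉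
  where
  pd′ = IsPipeDream-dropFirstColumn n P pd
  open FirstColumnCells {P} (firstColumn-bubbled n P pd) (δ-positive n (dropFirstColumn P) pd′)
  addable-∉ : ∀ i j → AddableCell (dominant (δ (suc n) P)) i j → ¬ cellsOf P i j
  addable-∉ i zero (_ , () , _)
  addable-∉ i (suc zero) (1≤i , _ , ¬d , up , _) Pi1 with <-cmp i k
  ... | tri< i<k _ _ = ¬d (dominant-1 1≤i i<k)
  ... | tri> _ _ k<i@(s≤s k≤i-1) = <⇒≱ (dominant⇒<k (up (≤-<-trans 1≤k k<i))) k≤i-1
  ... | tri≈ _ refl _ with trans (sym Q-k) Pi1
  ...   | ()
  addable-∉ i (suc (suc j)) (1≤i , _ , ¬d , up , left) =
    addable-dominant-δ∉ n (dropFirstColumn P) pd′ i (suc j)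
      (1≤i , z<s , ¬d ∘ dominant-suc⁺ i<k , (λ 1<i → dominant-suc⁻ (up 1<i) z<s) ,
       λ 1<j+1 → dominant-suc⁻ (left (s≤s z<s)) (≤-pred 1<j+1))
    where i<k = dominant⇒<k (left (s≤s z<s))

-- Young diagrams

part-antitone : ∀ {λ′ a b} → Linked (λ x y → y ≤ x) λ′ → a ≤ b → part λ′ b ≤ part λ′ a
part-antitone {[]}                           _         _         = z≤n
part-antitone {x ∷ []}     {b = zero}        _         z≤n       = ≤-refl
part-antitone {x ∷ []}     {b = suc b}       _         _         = z≤n
part-antitone {x ∷ y ∷ λ′} {zero}  {zero}    _         _         = ≤-refl
part-antitone {x ∷ y ∷ λ′} {zero}  {suc b}   (y≤x ∷ L) _         = ≤-trans (part-antitone {a = zero} {b = b} L z≤n) y≤x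
part-antitone {x ∷ y ∷ λ′} {suc a} {suc b}   (_ ∷ L)   (s≤s a≤b) = part-antitone L a≤b

Young-down : ∀ {λ′ i j a} → IsPartition λ′ → Young λ′ i j → 1 ≤ a → a ≤ i → Young λ′ a j
Young-down (_ , L) (_ , 1≤j , j≤λi) 1≤a a≤i =
  1≤a , 1≤j , ≤-trans j≤λi (part-antitone L (∸-monoˡ-≤ 1 a≤i))

IsPartition-replicate : ∀ i {j} → 1 ≤ j → IsPartition (replicate i j)
IsPartition-replicate i 1≤j = replicate⁺ i 1≤j , linked i
  where
  linked : ∀ i → Linked (λ x y → y ≤ x) (replicate i _)
  linked zero          = []
  linked (suc zero)    = [-]
  linked (suc (suc i)) = ≤-refl ∷ linked (suc i)

part-replicate-< : ∀ {i j c} → c < i → part (replicate i j) c ≡ j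
part-replicate-< {suc i} {c = zero}  _         = refl
part-replicate-< {suc i} {c = suc c} (s≤s c<i) = part-replicate-< c<i

part-replicate-≥ : ∀ {i j c} → i ≤ c → part (replicate i j) c ≡ 0
part-replicate-≥ {zero}                z≤n       = refl
part-replicate-≥ {suc i} {c = suc c} (s≤s i≤c) = part-replicate-≥ i≤c

Young-replicate⁻ : ∀ {i j a b} → Young (replicate i j) a b → a ≤ i × b ≤ j
Young-replicate⁻ {i} {j} {a} {b} (s≤s _ , 1≤b , b≤part) with a ∸ 1 <? i
... | yes a-1<i = a-1<i , subst (b ≤_) (part-replicate-< a-1<i) b≤part
... | no  a-1≮i = ⊥-elim (<⇒≱ 1≤b (subst (b ≤_) (part-replicate-≥ (≮⇒≥ a-1≮i)) b≤part))

Young-replicate-corner : ∀ {i j} → 1 ≤ i → 1 ≤ j → Young (replicate i j) i j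
Young-replicate-corner 1≤i@(s≤s {n = i′} _) 1≤j =
  1≤i , 1≤j , ≤-reflexive (sym (part-replicate-< (n<1+n i′)))

addable∉⇒Young⊆ : ∀ {U λ′ μ} → IsPartition μ → Young μ ⊆ U
                     → (∀ i j → AddableCell (Young λ′) i j → ¬ U i j) → Young μ ⊆ Young λ′
addable∉⇒Young⊆ {U} {λ′} {μ} μ-part μ⊆U addable∉U i j = bounded (i + j) ≤-refl
  where
  bounded : ∀ s {i j} → i + j ≤ s → Young μ i j → Young λ′ i j
  bounded s {zero}          _ (() , _)
  bounded s {suc i} {zero}  _ (_ , () , _)
  bounded zero {suc i} {suc j} () _
  bounded (suc s) {suc i} {suc j} i+j≤s y@(1≤i , 1≤j , j≤μi) with suc j ≤? part λ′ i
  ... | yes j≤λi = 1≤i , 1≤j , j≤λi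
  ... | no  j≰λi = ⊥-elim (addable∉U (suc i) (suc j) addable (μ⊆U _ _ y))
    where
    addable : AddableCell (Young λ′) (suc i) (suc j)
    addable = 1≤i , 1≤j , (λ y′ → j≰λi (proj₂ (proj₂ y′))) ,
              (λ 1<i+1 → bounded s (≤-pred i+j≤s) (Young-down μ-part y (≤-pred 1<i+1) (n≤1+n i))) ,
              (λ 1<j+1 → bounded s (subst (_≤ s) (+-suc i j) (≤-pred i+j≤s))
                                   (1≤i , ≤-pred 1<j+1 , ≤-trans (n≤1+n j) j≤μi))

fun-injective : ∀ w → Injective _≡_ _≡_ (fun w)
fun-injective w {a} {b} wa≡wb = trans (sym (inv-fun w a)) (trans (cong (inv w) wa≡wb) (inv-fun w b))

inv-positive : ∀ w {b} → 1 ≤ b → 1 ≤ inv w b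
inv-positive w = injective⇒positive inv-injective inv-0
  where
  inv-injective : Injective _≡_ _≡_ (inv w)
  inv-injective {a} {b} w⁻¹a≡w⁻¹b =
    trans (sym (fun-inv w a)) (trans (cong (fun w) w⁻¹a≡w⁻¹b) (fun-inv w b))
  inv-0 : inv w 0 ≡ 0
  inv-0 = trans (cong (inv w) (sym (fun-0 w))) (inv-fun w 0)

rectangle-⊆-Rothe : ∀ w {i j} → dominant (fun w) i j → Young (replicate i j) ⊆ Rothe w
rectangle-⊆-Rothe w {i} {j} (_ , _ , below) a b y@(1≤a , 1≤b , _) =
  1≤a , 1≤b , ≤-<-trans b≤j (below 1≤a a≤i) , ≰⇒> w⁻¹b≰a
  where
  a≤i : a ≤ i
  a≤i = proj₁ (Young-replicate⁻ {i} {j} y)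
  b≤j : b ≤ j
  b≤j = proj₂ (Young-replicate⁻ {i} {j} y)
  w⁻¹b≰a : ¬ inv w b ≤ a
  w⁻¹b≰a w⁻¹b≤a =
    <-irrefl (sym (fun-inv w b)) (≤-<-trans b≤j (below (inv-positive w 1≤b) (≤-trans w⁻¹b≤a a≤i)))

Young≐dominant : ∀ w {λ′} → IsDom (Rothe w) λ′ → Young λ′ ≐ dominant (fun w)
Young≐dominant w {λ′} (λ-part , Y⊆D , maximal) = Young⊆dominant , dominant⊆Young
  where
  Young⊆dominant : Young λ′ ⊆ dominant (fun w)
  Young⊆dominant i j y@(1≤i , 1≤j , _) = 1≤i , 1≤j , λ 1≤a a≤i →
    proj₁ (proj₂ (proj₂ (Y⊆D _ j (Young-down λ-part y 1≤a a≤i))))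
  dominant⊆Young : dominant (fun w) ⊆ Young λ′
  dominant⊆Young i j d@(1≤i , 1≤j , _) =
    maximal (replicate i j) (IsPartition-replicate i 1≤j) (rectangle-⊆-Rothe w d)
            i j (Young-replicate-corner 1≤i 1≤j)

lemma5p4 : (n : ℕ) (w : Perm) → (∀ k → n < k → fun w k ≡ k)
    → (λd : List ℕ) → IsDom (Rothe w) λd
    → (∀ i j → Addable λd i j → j ≡ fun w i)
      × (∀ (P : ℕ → ℕ → Bool) → InPipesBar n w P → IsDom (cellsOf P) λd)
      × (∀ (P : ℕ → ℕ → Bool) → InPipesBar n w P → ∀ i j → Addable λd i j → ¬ cellsOf P i j)
lemma5p4 n w _ λd isDom = addable≡ , dom-pipe , addable∉
  where
  Y≐D = Young≐dominant w isDom
  Y≐Dδ : ∀ P → InPipesBar n w P → Young λd ≐ dominant (δ n P)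
  Y≐Dδ P (pd , δP≗w) =
    ≐-trans Y≐D (dominant-cong (λ k → trans (sym (δP≗w k)) (demazure≗δ n P pd k)))
  addable≡ : ∀ i j → Addable λd i j → j ≡ fun w i
  addable≡ i j =
    addable-dominant⇒≡ (injective⇒positive (fun-injective w) (fun-0 w)) i j ∘ AddableCell-resp Y≐D i j
  addable∉ : ∀ P → InPipesBar n w P → ∀ i j → Addable λd i j → ¬ cellsOf P i j
  addable∉ P ip@(pd , _) i j = addable-dominant-δ∉ n P pd i j ∘ AddableCell-resp (Y≐Dδ P ip) i j
  dom-pipe : ∀ P → InPipesBar n w P → IsDom (cellsOf P) λd
  dom-pipe P ip@(pd , _) = proj₁ isDom , (λ i j → dominant-δ⊆ n P pd i j ∘ proj₁ (Y≐Dδ P ip) i j) ,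
                           λ μ μ-part μ⊆P → addable∉⇒Young⊆ {λ′ = λd} μ-part μ⊆P (addable∉ P ip)
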